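{- Let $n>3$, $n_1=n(n+1)/2$ and let $[G]$ be a binding graph of order $n_1$. Then in the stable partition of $[G]$ no cell contains both a basic vertex and a binding vertex.
   Context: Labeled graphs: $\mathrm{Var}$ is an infinite set of independent variables and $x_0\notin\mathrm{Var}$ a reserved symbol. A labeled graph of order $N$ is an $N\times N$ matrix $G=(g_{ij})$ with entries in $\{x_0\}\cup\mathrm{Var}$; vertex set $[N]$, $g_{ii}$ is the label of vertex $i$; for $i\neq j$, $(i,j)$ is an edge iff $g_{ij}\ne x_0$. $\dim(G)$ is the number of distinct symbols in $G$. A simple graph has $G^\top=G$, $\dim(G)\le2$, $g_{ii}=x_0$. Diamond product: $(G\diamond G)_{ij}=\{\!\{(g_{ik},g_{kj}):k\in[N]\}\!\}$. $\mathrm{evs}(A)$ replaces entries of $A$ by variables of $\mathrm{Var}$ so that equal entries get equal variables and distinct entries distinct ones. WL algorithm: $G_1$ from $G$ by replacing diagonal entries by fresh variables (equal iff equal before, none occurring off-diagonal), $G_{t+1}=\mathrm{evs}(G_t\diamond G_t)$ until $\dim(G_t)=\dim(G_{t+1})$, $\mathrm{wl}(G):=G_t$. A cell is a maximal set of vertices with equal diagonal labels; the stable partition of $G$ is the partition into cells of $\mathrm{wl}(G)$. Binding graphs: a binding graph of order $n_1=n(n+1)/2$ is a simple graph such that for every pair of distinct $u,v\in[n]$ there is a unique vertex $u\wedge v\in[n+1,n_1]$ whose neighbours are exactly $u$ and $v$, distinct pairs giving distinct vertices; its subgraph induced on $[n]$ is the basic graph $G$ and it is denoted $[G]$. Vertices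 in $[n]$ are basic, those in $[n+1,n_1]$ are binding. -}

module Defs where

open import Data.Nat using (ℕ; zero; suc; _+_; _*_; _⊔_; _<_; _≤_)
open import Data.Nat.Properties using (≤-decTotalOrder) renaming (_≟_ to _≟ℕ_)
open import Data.Nat.DivMod using (_/_)
open import Data.Fin using (Fin; toℕ)
open import Data.Fin.Properties using () renaming (_≟_ to _≟F_)
open import Data.List using (List; []; _∷_; map; concatMap; allFin; length; deduplicate; foldr)
import Data.List.Properties as LP
import Data.Product.Properties as PP
open import Data.Product using (_×_; _,_; Σ-syntax)
open import Data.Product.Relation.Binary.Lex.NonStrict using (×-decTotalOrder)
open import Data.Sum using (_⊎_)
open import Data.Bool using (Bool; true; false; if_then_else_)
open import Relation.Nullary using (¬_; does)
open import Relation.Binary.PropositionalEquality using (_≡_; _≢_)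
open import Relation.Binary.Definitions using (DecidableEquality)
open import Function.Bundles using (_⇔_)
import Data.List.Sort.InsertionSort.Base as ISort

-- Labels / symbols.
-- We identify the set of symbols {x₀} ∪ Var with ℕ: the reserved symbol
-- x₀ is 0 and Var is the (infinite) set of positive naturals.

x₀ : ℕ
x₀ = 0

LGraph : ℕ → Set
LGraph N = Fin N → Fin N → ℕ

entries : ∀ {N} {A : Set} → (Fin N → Fin N → A) → List A
entries {N} M = concatMap (λ i → map (M i) (allFin N)) (allFin N)

dimM : ∀ {N} {A : Set} → DecidableEquality A → (Fin N → Fin N → A) → ℕ
dimM _≟_ M = length (deduplicate _≟_ (entries M))

dim : ∀ {N} → LGraph N → ℕ
dim = dimM _≟ℕ_

indexOf : {A : Set} → DecidableEquality A → A → List A → ℕ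
indexOf _≟_ x [] = 0
indexOf _≟_ x (y ∷ ys) = if does (x ≟ y) then 0 else suc (indexOf _≟_ x ys)

-- evs(A): each entry replaced by a variable (a positive natural) such that
-- equal entries get equal variables and distinct entries distinct ones
-- (we use 1 + position of first occurrence of the entry in row-major order).
evs : ∀ {N} {A : Set} → DecidableEquality A → (Fin N → Fin N → A) → LGraph N
evs _≟_ M i j = suc (indexOf _≟_ (M i j) (entries M))

-- Multisets of pairs of symbols, represented canonically by sorted lists.

module PairSort = ISort (×-decTotalOrder ≤-decTotalOrder ≤-decTotalOrder)

Multiset₂ : Set
Multiset₂ = List (ℕ × ℕ)

_≟M_ : DecidableEquality Multiset₂
_≟M_ = LP.≡-dec (PP.≡-dec _≟ℕ_ _≟ℕ_)

diamond : ∀ {N} → LGraph N → Fin N → Fin N → Multiset₂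
diamond {N} G i j = PairSort.sort (map (λ k → (G i k , G k j)) (allFin N))

maxEntry : ∀ {N} → LGraph N → ℕ
maxEntry G = foldr _⊔_ 0 (entries G)

-- G₁: diagonal entries replaced by fresh variables (equal iff equal before,
-- none occurring off-diagonal); off-diagonal entries unchanged.
G₁ : ∀ {N} → LGraph N → LGraph N
G₁ G i j = if does (i ≟F j) then suc (maxEntry G + G i j) else G i j

-- WLstage G t = G_{t+1}
WLstage : ∀ {N} → LGraph N → ℕ → LGraph N
WLstage G zero = G₁ G
WLstage G (suc t) = evs _≟M_ (diamond (WLstage G t))

-- s is the stopping index: G_{s+1} is the first G_t (t ≥ 1) with
-- dim(G_t) = dim(G_{t+1}); then wl(G) = G_{s+1} = WLstage G s.
WLStopsAt : ∀ {N} → LGraph N → ℕ → Set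
WLStopsAt G s = (dim (WLstage G s) ≡ dim (WLstage G (suc s)))
              × (∀ r → r < s → dim (WLstage G r) ≢ dim (WLstage G (suc r)))

SameCell : ∀ {N} → LGraph N → Fin N → Fin N → Set
SameCell H u v = H u u ≡ H v v

IsSimple : ∀ {N} → LGraph N → Set
IsSimple {N} G = (∀ i j → G i j ≡ G j i) × (dim G ≤ 2) × (∀ i → G i i ≡ x₀)

Adj : ∀ {N} → LGraph N → Fin N → Fin N → Set
Adj G i j = (i ≢ j) × (G i j ≢ x₀)

NbrsExactly : ∀ {N} → LGraph N → Fin N → Fin N → Fin N → Set
NbrsExactly {N} G w u v = ∀ (x : Fin N) → Adj G w x ⇔ ((x ≡ u) ⊎ (x ≡ v))

order : ℕ → ℕ
order n = (n * suc n) / 2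

-- vertices [1,n] (here: 0-based indices < n) are basic,
-- vertices [n+1,n₁] (here: indices ≥ n) are binding
Basic : ∀ (n : ℕ) → Fin (order n) → Set
Basic n v = toℕ v < n

Binding : ∀ (n : ℕ) → Fin (order n) → Set
Binding n v = n ≤ toℕ v

IsBindingGraph : ∀ (n : ℕ) → LGraph (order n) → Set
IsBindingGraph n G =
    IsSimple G
  × (∀ u v → Basic n u → Basic n v → u ≢ v →
       Σ[ w ∈ Fin (order n) ] (Binding n w × NbrsExactly G w u v
         × (∀ w′ → Binding n w′ → NbrsExactly G w′ u v → w′ ≡ w)))
  × (∀ u v u′ v′ w → Basic n u → Basic n v → Basic n u′ → Basic n v′ →
       u ≢ v → u′ ≢ v′ → Binding n w →
       NbrsExactly G w u v → NbrsExactly G w u′ v′ →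
       ((u ≡ u′) × (v ≡ v′)) ⊎ ((u ≡ v′) × (v ≡ u′)))

module Submission where

-- After G₁ every WL stage keeps diagonal colours off the diagonal, and then each stage refines the
-- previous one: the multiset of walks at (i , j) contains the walk through the diagonal entry (i , i),
-- which recovers the old colour of (i , j). So every stage refines the adjacency of G, and equal
-- diagonal colours at stage t + 1 give equally many edge-coloured entries in the two rows at stage t,
-- i.e. equal degrees. In a binding graph a basic vertex u has the n − 1 ≥ 3 neighbours u ∧ v, while
-- every binding vertex is some u ∧ v (there are n(n − 1)/2 of each and u ∧ v is injective), so it has
-- degree 2. Finally the algorithm cannot stop at G₁: it has at most 3 symbols and G₂ at least 4.

open import Defs
open import Data.Nat using (ℕ; zero; suc; pred; _+_; _*_; _∸_; _⊔_; _<_; _≤_; z≤n; s≤s; z<s; s<s)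
open import Data.Nat.Properties
open import Data.Nat.DivMod using (_/_; m*n/n≡m)
open import Data.Nat.Tactic.RingSolver using (solve-∀)
open import Data.Fin using (Fin; toℕ; fromℕ<; splitAt; join; punchIn; punchOut)
open import Data.Fin.Properties
  using (toℕ-injective; toℕ-fromℕ<; toℕ<n; join-splitAt; punchIn-injective; punchInᵢ≢i;
         punchOut-injective; injective⇒≤; any?)
  renaming (_≟_ to _≟F_)
open import Data.List using (List; []; _∷_; _++_; map; filter; allFin; length; deduplicate; foldr)
open import Data.List.Properties using (length-++-sucʳ; length-map; length-tabulate; filter-≐)
open import Data.List.Membership.Propositional using (_∈_)
open import Data.List.Membership.Propositional.Properties
  using (∈-∃++; ∈-++⁻; ∈-++⁺ˡ; ∈-++⁺ʳ; ∈-map⁺; ∈-map⁻; ∈-allFin; ∈-concatMap⁺; ∈-concatMap⁻;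
         ∈-filter⁺; ∈-filter⁻; ∈-deduplicate⁺; ∈-deduplicate⁻)
open import Data.List.Relation.Unary.Any using (Any; here; there)
import Data.List.Relation.Unary.Any as Any
import Data.List.Relation.Unary.Any.Properties as Anyₚ
import Data.List.Relation.Unary.All as All
open import Data.List.Relation.Unary.All using ([]; _∷_)
open import Data.List.Relation.Unary.AllPairs using ([]; _∷_)
open import Data.List.Relation.Unary.Unique.Propositional using (Unique)
import Data.List.Relation.Unary.Unique.Propositional.Properties as Uniqueₚ
open import Data.List.Relation.Unary.Unique.DecPropositional.Properties using (deduplicate-!)
open import Data.List.Relation.Binary.Subset.Propositional using (_⊆_)
open import Data.List.Relation.Binary.Permutation.Propositional using (_↭_; ↭-sym; ↭-trans; ↭-reflexive)
open import Data.List.Relation.Binary.Permutation.Propositional.Properties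
  using (Any-resp-↭; filter-↭; ↭-length)
import Data.List.Sort.InsertionSort.Properties as InsertionSortₚ
open import Data.Product using (_×_; _,_; Σ-syntax; ∃; ∃₂; proj₁; proj₂)
import Data.Product as Product
open import Data.Product.Properties using (×-≡,≡→≡)
open import Data.Product.Relation.Binary.Lex.NonStrict using (×-decTotalOrder)
open import Data.Sum using (_⊎_; inj₁; inj₂; [_,_]′)
open import Function using (_∘_; id)
open import Function.Bundles using (Equivalence)
open import Function.Definitions using (Injective)
open import Level using (0ℓ)
open import Relation.Nullary using (¬_; Dec; yes; no; contradiction)
open import Relation.Nullary.Decidable using (¬?; _×-dec_)
open import Relation.Unary using (Pred; Decidable; _≐_)
open import Relation.Binary.PropositionalEquality
open import Relation.Binary.Definitions using (DecidableEquality)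


Unique⇒length≤ : ∀ {A : Set} {xs ys : List A} → Unique xs → xs ⊆ ys → length xs ≤ length ys
Unique⇒length≤ {xs = []} _ _ = z≤n
Unique⇒length≤ {xs = x ∷ xs} (x∉xs ∷ xs!) xs⊆ys with ys₁ , ys₂ , refl ← ∈-∃++ (xs⊆ys (here refl)) =
  ≤-trans (s≤s (Unique⇒length≤ xs! xs⊆ys₁++ys₂)) (≤-reflexive (sym (length-++-sucʳ ys₁ x ys₂)))
  where
  xs⊆ys₁++ys₂ : xs ⊆ ys₁ ++ ys₂
  xs⊆ys₁++ys₂ z∈xs with ∈-++⁻ ys₁ (xs⊆ys (there z∈xs))
  ... | inj₁ z∈ys₁ = ∈-++⁺ˡ z∈ys₁
  ... | inj₂ (here refl) = contradiction refl (All.lookup x∉xs z∈xs)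
  ... | inj₂ (there z∈ys₂) = ∈-++⁺ʳ ys₁ z∈ys₂

length-filter-map : ∀ {A B : Set} {P : Pred B 0ℓ} (P? : Decidable P) (f : A → B) (xs : List A) →
                    length (filter P? (map f xs)) ≡ length (filter (P? ∘ f) xs)
length-filter-map P? f [] = refl
length-filter-map P? f (x ∷ xs) with P? (f x)
... | yes _ = cong suc (length-filter-map P? f xs)
... | no _ = length-filter-map P? f xs

∈⇒≤foldr-⊔ : ∀ {x} (xs : List ℕ) → x ∈ xs → x ≤ foldr _⊔_ 0 xs
∈⇒≤foldr-⊔ (y ∷ xs) (here refl) = m≤m⊔n y _
∈⇒≤foldr-⊔ (y ∷ xs) (there x∈xs) = ≤-trans (∈⇒≤foldr-⊔ xs x∈xs) (m≤n⊔m y _)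


injective⇒surjective : ∀ {m} {f : Fin m → Fin m} → Injective _≡_ _≡_ f → ∀ y → ∃ λ x → f x ≡ y
injective⇒surjective {suc m} {f} f-injective y with any? (λ x → f x ≟F y)
... | yes hit = hit
... | no miss = contradiction (injective⇒≤ punchOut∘f-injective) 1+n≰n
  where
  y≢f : ∀ x → y ≢ f x
  y≢f x y≡fx = miss (x , sym y≡fx)

  punchOut∘f-injective : Injective _≡_ _≡_ (λ x → punchOut (y≢f x))
  punchOut∘f-injective eq = f-injective (punchOut-injective (y≢f _) (y≢f _) eq)

punchIn-avoiding : ∀ {m} (i : Fin m) →
                   Σ[ f ∈ (Fin (pred m) → Fin m) ] Injective _≡_ _≡_ f × (∀ j → f j ≢ i)
punchIn-avoiding {suc m} i = punchIn i , punchIn-injective i _ _ , punchInᵢ≢i i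

splitAt-injective : ∀ m {n} → Injective _≡_ _≡_ (splitAt m {n})
splitAt-injective m {n} {i} {j} eq = begin
  i                      ≡⟨ join-splitAt m n i ⟨
  join m n (splitAt m i) ≡⟨ cong (join m n) eq ⟩
  join m n (splitAt m j) ≡⟨ join-splitAt m n j ⟩
  j                      ∎
  where open ≡-Reasoning


choose₂ : ℕ → ℕ
choose₂ zero = 0
choose₂ (suc m) = choose₂ m + m

-- The last m indices of Fin (choose₂ (suc m)) enumerate the new pairs (a , m).
pair : ∀ m → Fin (choose₂ m) → ℕ × ℕ
pair (suc m) i = [ pair m , (λ a → toℕ a , m) ]′ (splitAt (choose₂ m) i)

pair-< : ∀ m i → proj₁ (pair m i) < proj₂ (pair m i) × proj₂ (pair m i) < m
pair-< (suc m) i with splitAt (choose₂ m) i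
... | inj₁ j = Product.map₂ m<n⇒m<1+n (pair-< m j)
... | inj₂ a = toℕ<n a , n<1+n m

pair-injective : ∀ m → Injective _≡_ _≡_ (pair m)
pair-injective (suc m) eq = splitAt-injective (choose₂ m) (≡-on-splits _ _ eq)
  where
  ≡-on-splits : ∀ s t → [ pair m , (λ a → toℕ a , m) ]′ s ≡ [ pair m , (λ a → toℕ a , m) ]′ t → s ≡ t
  ≡-on-splits (inj₁ i) (inj₁ j) eq = cong inj₁ (pair-injective m eq)
  ≡-on-splits (inj₁ i) (inj₂ b) eq = contradiction (cong proj₂ eq) (<⇒≢ (proj₂ (pair-< m i)))
  ≡-on-splits (inj₂ a) (inj₁ j) eq = contradiction (sym (cong proj₂ eq)) (<⇒≢ (proj₂ (pair-< m j)))
  ≡-on-splits (inj₂ a) (inj₂ b) eq = cong inj₂ (toℕ-injective (cong proj₁ eq))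

m*[1+m]≡[m+choose₂m]*2 : ∀ m → m * suc m ≡ (m + choose₂ m) * 2
m*[1+m]≡[m+choose₂m]*2 zero = refl
m*[1+m]≡[m+choose₂m]*2 (suc m) = begin
  suc m * suc (suc m)                   ≡⟨ expand m ⟩
  m * suc m + suc m * 2                 ≡⟨ cong (_+ suc m * 2) (m*[1+m]≡[m+choose₂m]*2 m) ⟩
  (m + choose₂ m) * 2 + suc m * 2       ≡⟨ regroup m (choose₂ m) ⟩
  (suc m + (choose₂ m + m)) * 2         ∎
  where
  open ≡-Reasoning
  expand : ∀ m → suc m * suc (suc m) ≡ m * suc m + suc m * 2
  expand = solve-∀
  regroup : ∀ m c → (m + c) * 2 + suc m * 2 ≡ (suc m + (c + m)) * 2
  regroup = solve-∀

order≡n+choose₂n : ∀ n → order n ≡ n + choose₂ n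
order≡n+choose₂n n = trans (cong (_/ 2) (m*[1+m]≡[m+choose₂m]*2 n)) (m*n/n≡m (n + choose₂ n) 2)


module _ {N : ℕ} {A : Set} where

  ∈-entries : (M : Fin N → Fin N → A) (i j : Fin N) → M i j ∈ entries M
  ∈-entries M i j = ∈-concatMap⁺ (λ i → map (M i) (allFin N))
                                 (Any.map (λ { refl → ∈-map⁺ (M i) (∈-allFin j) }) (∈-allFin i))

  ∈-entries⁻ : (M : Fin N → Fin N → A) {x : A} → x ∈ entries M → ∃₂ λ i j → x ≡ M i j
  ∈-entries⁻ M x∈
    with i , x∈row ← Any.satisfied (∈-concatMap⁻ (λ i → map (M i) (allFin N)) {xs = allFin N} x∈)
    with j , _ , x≡ ← ∈-map⁻ (M i) x∈row
    = i , j , x≡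

  indexOf-injective : (_≟_ : DecidableEquality A) {x y : A} {xs : List A} → x ∈ xs → y ∈ xs →
                      indexOf _≟_ x xs ≡ indexOf _≟_ y xs → x ≡ y
  indexOf-injective _≟_ {x} {y} {z ∷ zs} x∈ y∈ eq with x ≟ z | y ≟ z
  ... | yes x≡z | yes y≡z = trans x≡z (sym y≡z)
  ... | yes _   | no _    = contradiction eq 0≢1+n
  ... | no _    | yes _   = contradiction (sym eq) 0≢1+n
  ... | no x≢z  | no y≢z  = indexOf-injective _≟_ (Any.tail x≢z x∈) (Any.tail y≢z y∈) (suc-injective eq)

  evs-injective : (_≟_ : DecidableEquality A) (M : Fin N → Fin N → A) {i j k l : Fin N} →
                  evs _≟_ M i j ≡ evs _≟_ M k l → M i j ≡ M k l
  evs-injective _≟_ M {i} {j} {k} {l} eq =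
    indexOf-injective _≟_ (∈-entries M i j) (∈-entries M k l) (suc-injective eq)

≤-maxEntry : ∀ {N} (G : LGraph N) i j → G i j ≤ maxEntry G
≤-maxEntry G i j = ∈⇒≤foldr-⊔ (entries G) (∈-entries G i j)


refine : ∀ {N} → LGraph N → LGraph N
refine M = evs _≟M_ (diamond M)

walks : ∀ {N} → LGraph N → Fin N → Fin N → List (ℕ × ℕ)
walks {N} M i j = map (λ k → M i k , M k j) (allFin N)

module _ {N : ℕ} (M : LGraph N) where

  open InsertionSortₚ (×-decTotalOrder ≤-decTotalOrder ≤-decTotalOrder) using (sort-↭)

  refine-≡⇒↭ : ∀ {i j i′ j′} → refine M i j ≡ refine M i′ j′ → walks M i j ↭ walks M i′ j′
  refine-≡⇒↭ eq =
    ↭-trans (↭-sym (sort-↭ _)) (↭-trans (↭-reflexive (evs-injective _≟M_ (diamond M) eq)) (sort-↭ _))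

  refine-≡⇒∃ : ∀ {P : ℕ × ℕ → Set} {i j i′ j′} → refine M i j ≡ refine M i′ j′ →
               ∀ k → P (M i′ k , M k j′) → ∃ λ m → P (M i m , M m j)
  refine-≡⇒∃ {P} {i′ = i′} {j′} eq k p =
    Any.satisfied (Anyₚ.map⁻ (Any-resp-↭ (↭-sym (refine-≡⇒↭ eq)) walk∈))
    where
    walk∈ : Any P (walks M i′ j′)
    walk∈ = Anyₚ.map⁺ {P = P} (Any.map (λ { refl → p }) (∈-allFin k))

  refine-≡⇒count≡ : ∀ {P : Pred ℕ 0ℓ} (P? : Decidable P) {u v} → refine M u u ≡ refine M v v →
                    length (filter (P? ∘ M u) (allFin N)) ≡ length (filter (P? ∘ M v) (allFin N))
  refine-≡⇒count≡ P? {u} {v} eq = begin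
    length (filter (P? ∘ M u) (allFin N))        ≡⟨ length-filter-map (P? ∘ proj₁) _ (allFin N) ⟨
    length (filter (P? ∘ proj₁) (walks M u u))   ≡⟨ ↭-length (filter-↭ (P? ∘ proj₁) (refine-≡⇒↭ eq)) ⟩
    length (filter (P? ∘ proj₁) (walks M v v))   ≡⟨ length-filter-map (P? ∘ proj₁) _ (allFin N) ⟩
    length (filter (P? ∘ M v) (allFin N))        ∎
    where open ≡-Reasoning

SeparatesDiagonal : ∀ {N} → LGraph N → Set
SeparatesDiagonal M = ∀ {i j k} → i ≢ j → M i j ≢ M k k

module _ {N : ℕ} {M : LGraph N} (separates : SeparatesDiagonal M) where

  diagonal-colour : ∀ {i m k} → M i m ≡ M k k → i ≡ m
  diagonal-colour {i} {m} eq with i ≟F m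
  ... | yes i≡m = i≡m
  ... | no i≢m = contradiction eq (separates i≢m)

  refine-separates : SeparatesDiagonal (refine M)
  refine-separates {i} {j} {k} i≢j eq
    with m , (_ , i-diag) , (_ , j-diag) ←
           refine-≡⇒∃ M {P = λ p → (∃ λ a → proj₁ p ≡ M a a) × (∃ λ b → proj₂ p ≡ M b b)}
                      eq k ((k , refl) , (k , refl))
    = i≢j (trans (diagonal-colour i-diag) (diagonal-colour j-diag))

  refine-refines : ∀ {i j i′ j′} → refine M i j ≡ refine M i′ j′ → M i j ≡ M i′ j′
  refine-refines {i} {j} {i′} {j′} eq
    with m , i-diag , m-j ←
           refine-≡⇒∃ M {P = λ p → proj₁ p ≡ M i′ i′ × proj₂ p ≡ M i′ j′} eq i′ (refl , refl)
    with refl ← diagonal-colour i-diag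
    = m-j


Adj? : ∀ {N} (G : LGraph N) i j → Dec (Adj G i j)
Adj? G i j = ¬? (i ≟F j) ×-dec ¬? (G i j ≟ x₀)

degree : ∀ {N} → LGraph N → Fin N → ℕ
degree {N} G u = length (filter (Adj? G u) (allFin N))

module _ {N : ℕ} (G : LGraph N) where

  G₁-off-diagonal : ∀ {i j} → i ≢ j → G₁ G i j ≡ G i j
  G₁-off-diagonal {i} {j} i≢j with i ≟F j
  ... | yes i≡j = contradiction i≡j i≢j
  ... | no _ = refl

  G₁-diagonal : ∀ k → G₁ G k k ≡ suc (maxEntry G + G k k)
  G₁-diagonal k with k ≟F k
  ... | yes _ = refl
  ... | no k≢k = contradiction refl k≢k

  G₁-separates : SeparatesDiagonal (G₁ G)
  G₁-separates {i} {j} {k} i≢j eq = <-irrefl eq (begin-strict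
    G₁ G i j                 ≡⟨ G₁-off-diagonal i≢j ⟩
    G i j                    ≤⟨ ≤-maxEntry G i j ⟩
    maxEntry G               ≤⟨ m≤m+n (maxEntry G) (G k k) ⟩
    maxEntry G + G k k       <⟨ n<1+n _ ⟩
    suc (maxEntry G + G k k) ≡⟨ G₁-diagonal k ⟨
    G₁ G k k                 ∎)
    where open ≤-Reasoning

  G₁-respects-Adj : ∀ {i j i′ j′} → G₁ G i j ≡ G₁ G i′ j′ → Adj G i j → Adj G i′ j′
  G₁-respects-Adj {i} {j} {i′} {j′} eq (i≢j , edge) =
    i′≢j′ , λ non-edge → edge (trans (sym (G₁-off-diagonal i≢j))
                                (trans eq (trans (G₁-off-diagonal i′≢j′) non-edge)))
    where
    i′≢j′ : i′ ≢ j′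
    i′≢j′ refl = G₁-separates i≢j eq

  dim-G₁≤ : ∀ {c} → (∀ i → G i i ≡ c) → dim (G₁ G) ≤ suc (dim G)
  dim-G₁≤ {c} diagonal = Unique⇒length≤ (deduplicate-! _≟_ (entries (G₁ G))) ⊆fresh∷entries
    where
    ⊆fresh∷entries : deduplicate _≟_ (entries (G₁ G)) ⊆
                     suc (maxEntry G + c) ∷ deduplicate _≟_ (entries G)
    ⊆fresh∷entries z∈ with i , j , refl ← ∈-entries⁻ (G₁ G) (∈-deduplicate⁻ _≟_ (entries (G₁ G)) z∈)
                      with i ≟F j
    ... | yes refl = here (cong (λ d → suc (maxEntry G + d)) (diagonal i))
    ... | no _ = there (∈-deduplicate⁺ _≟_ (∈-entries G i j))

  stage-separates : ∀ t → SeparatesDiagonal (WLstage G t)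
  stage-separates zero = G₁-separates
  stage-separates (suc t) = refine-separates (stage-separates t)

  stage-refines-G₁ : ∀ t {i j i′ j′} → WLstage G t i j ≡ WLstage G t i′ j′ → G₁ G i j ≡ G₁ G i′ j′
  stage-refines-G₁ zero eq = eq
  stage-refines-G₁ (suc t) eq = stage-refines-G₁ t (refine-refines (stage-separates t) eq)

  stage-respects-Adj : ∀ t {i j i′ j′} → WLstage G t i j ≡ WLstage G t i′ j′ → Adj G i j → Adj G i′ j′
  stage-respects-Adj t eq = G₁-respects-Adj (stage-refines-G₁ t eq)

  EdgeColour : LGraph N → ℕ → Set
  EdgeColour M c = ∃₂ λ x y → Adj G x y × M x y ≡ c

  EdgeColour? : ∀ M → Decidable (EdgeColour M)
  EdgeColour? M c = any? λ x → any? λ y → Adj? G x y ×-dec (M x y ≟ c)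

  next-stage-degree : ∀ t {u v} → SameCell (WLstage G (suc t)) u v → degree G u ≡ degree G v
  next-stage-degree t {u} {v} same = begin
    degree G u                                        ≡⟨ edge-coloured-row u ⟨
    length (filter (EdgeColour? M ∘ M u) (allFin N))  ≡⟨ refine-≡⇒count≡ M (EdgeColour? M) same ⟩
    length (filter (EdgeColour? M ∘ M v) (allFin N))  ≡⟨ edge-coloured-row v ⟩
    degree G v                                        ∎
    where
    open ≡-Reasoning
    M : LGraph N
    M = WLstage G t

    row≐Adj : ∀ w → (EdgeColour M ∘ M w) ≐ Adj G w
    row≐Adj w = (λ (_ , _ , adj , eq) → stage-respects-Adj t eq adj) , λ {k} adj → w , k , adj , refl

    edge-coloured-row : ∀ w → length (filter (EdgeColour? M ∘ M w) (allFin N)) ≡ degree G w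
    edge-coloured-row w = cong length (filter-≐ _ _ (row≐Adj w) (allFin N))

  injective⇒≤degree : ∀ {m u} (f : Fin m → Fin N) → Injective _≡_ _≡_ f → (∀ i → Adj G u (f i)) →
                      m ≤ degree G u
  injective⇒≤degree {m} {u} f f-injective adjacent = begin
    m                             ≡⟨ length-tabulate id ⟨
    length (allFin m)             ≡⟨ length-map f (allFin m) ⟨
    length (map f (allFin m))     ≤⟨ Unique⇒length≤ f[allFin]! ⊆nbrs ⟩
    degree G u                    ∎
    where
    open ≤-Reasoning
    f[allFin]! : Unique (map f (allFin m))
    f[allFin]! = Uniqueₚ.map⁺ f-injective (Uniqueₚ.allFin⁺ m)

    ⊆nbrs : map f (allFin m) ⊆ filter (Adj? G u) (allFin N)
    ⊆nbrs x∈ with i , _ , refl ← ∈-map⁻ f x∈ = ∈-filter⁺ (Adj? G u) (∈-allFin (f i)) (adjacent i)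

  NbrsExactly⇒degree≤2 : ∀ {v a b} → NbrsExactly G v a b → degree G v ≤ 2
  NbrsExactly⇒degree≤2 {v} {a} {b} nbrs =
    Unique⇒length≤ (Uniqueₚ.filter⁺ (Adj? G v) (Uniqueₚ.allFin⁺ N)) ⊆a∷b
    where
    ⊆a∷b : filter (Adj? G v) (allFin N) ⊆ a ∷ b ∷ []
    ⊆a∷b x∈ with Equivalence.to (nbrs _) (proj₂ (∈-filter⁻ (Adj? G v) {xs = allFin N} x∈))
    ... | inj₁ refl = here refl
    ... | inj₂ refl = there (here refl)


module BindingGraph (n : ℕ) (3<n : 3 < n) (G : LGraph (order n)) (isBinding : IsBindingGraph n G) where

  private
    N : ℕ
    N = order n

  G-symmetric : ∀ i j → G i j ≡ G j i
  G-symmetric = proj₁ (proj₁ isBinding)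

  dim-G≤2 : dim G ≤ 2
  dim-G≤2 = proj₁ (proj₂ (proj₁ isBinding))

  G-diagonal : ∀ i → G i i ≡ x₀
  G-diagonal = proj₂ (proj₂ (proj₁ isBinding))

  Adj-sym : ∀ {i j} → Adj G i j → Adj G j i
  Adj-sym {i} {j} (i≢j , edge) = i≢j ∘ sym , λ non-edge → edge (trans (G-symmetric i j) non-edge)

  module _ {a b : Fin N} (ba : Basic n a) (bb : Basic n b) (a≢b : a ≢ b) where

    binder : Fin N
    binder = proj₁ (proj₁ (proj₂ isBinding) a b ba bb a≢b)

    binder-Binding : Binding n binder
    binder-Binding = proj₁ (proj₂ (proj₁ (proj₂ isBinding) a b ba bb a≢b))

    binder-nbrs : NbrsExactly G binder a b
    binder-nbrs = proj₁ (proj₂ (proj₂ (proj₁ (proj₂ isBinding) a b ba bb a≢b)))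

    Adj-binder : Adj G a binder
    Adj-binder = Adj-sym (Equivalence.from (binder-nbrs a) (inj₁ refl))

  binder-≡ : ∀ {a b a′ b′} (ba : Basic n a) (bb : Basic n b) (ba′ : Basic n a′) (bb′ : Basic n b′)
             (a≢b : a ≢ b) (a′≢b′ : a′ ≢ b′) → binder ba bb a≢b ≡ binder ba′ bb′ a′≢b′ →
             ((a ≡ a′) × (b ≡ b′)) ⊎ ((a ≡ b′) × (b ≡ a′))
  binder-≡ ba bb ba′ bb′ a≢b a′≢b′ eq =
    proj₂ (proj₂ isBinding) _ _ _ _ _ ba bb ba′ bb′ a≢b a′≢b′ (binder-Binding ba bb a≢b)
      (binder-nbrs ba bb a≢b) (subst (λ w → NbrsExactly G w _ _) (sym eq) (binder-nbrs ba′ bb′ a′≢b′))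

  Basic≢Binding : ∀ {x w} → Basic n x → Binding n w → x ≢ w
  Basic≢Binding bx bw refl = <-irrefl refl (<-≤-trans bx bw)

  n≤order : n ≤ N
  n≤order = subst (n ≤_) (sym (order≡n+choose₂n n)) (m≤m+n n (choose₂ n))

  basic : ∀ k → k < n → Fin N
  basic k k<n = fromℕ< (<-≤-trans k<n n≤order)

  toℕ-basic : ∀ k (k<n : k < n) → toℕ (basic k k<n) ≡ k
  toℕ-basic k k<n = toℕ-fromℕ< (<-≤-trans k<n n≤order)

  basic-Basic : ∀ k (k<n : k < n) → Basic n (basic k k<n)
  basic-Basic k k<n = subst (_< n) (sym (toℕ-basic k k<n)) k<n

  basic-≡ : ∀ {k l} (k<n : k < n) (l<n : l < n) → basic k k<n ≡ basic l l<n → k ≡ l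
  basic-≡ {k} {l} k<n l<n eq = trans (sym (toℕ-basic k k<n)) (trans (cong toℕ eq) (toℕ-basic l l<n))

  basic-≢ : ∀ {k l} (k<n : k < n) (l<n : l < n) → k ≢ l → basic k k<n ≢ basic l l<n
  basic-≢ k<n l<n k≢l = k≢l ∘ basic-≡ k<n l<n

  basic-degree : ∀ {u} → Basic n u → 3 ≤ degree G u
  basic-degree {u} bu =
    ≤-trans (pred-mono-≤ 3<n) (injective⇒≤degree G neighbour neighbour-injective neighbour-adjacent)
    where
    others : Σ[ f ∈ (Fin (pred n) → Fin n) ] Injective _≡_ _≡_ f × (∀ j → f j ≢ fromℕ< bu)
    others = punchIn-avoiding (fromℕ< bu)

    other : Fin (pred n) → Fin N
    other j = basic (toℕ (proj₁ others j)) (toℕ<n _)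

    u≢other : ∀ j → u ≢ other j
    u≢other j u≡ = proj₂ (proj₂ others) j (toℕ-injective (begin
      toℕ (proj₁ others j) ≡⟨ toℕ-basic _ (toℕ<n _) ⟨
      toℕ (other j)        ≡⟨ cong toℕ u≡ ⟨
      toℕ u                ≡⟨ toℕ-fromℕ< bu ⟨
      toℕ (fromℕ< bu)      ∎))
      where open ≡-Reasoning

    neighbour : Fin (pred n) → Fin N
    neighbour j = binder bu (basic-Basic _ (toℕ<n _)) (u≢other j)

    neighbour-injective : Injective _≡_ _≡_ neighbour
    neighbour-injective {i} {j} eq with binder-≡ _ _ _ _ (u≢other i) (u≢other j) eq
    ... | inj₁ (_ , others≡) = proj₁ (proj₂ others) (toℕ-injective (basic-≡ (toℕ<n _) (toℕ<n _) others≡))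
    ... | inj₂ (u≡other , _) = contradiction u≡other (u≢other j)

    neighbour-adjacent : ∀ j → Adj G u (neighbour j)
    neighbour-adjacent j = Adj-binder bu _ (u≢other j)

  module _ (i : Fin (choose₂ n)) where

    pair₁<pair₂ : proj₁ (pair n i) < proj₂ (pair n i)
    pair₁<pair₂ = proj₁ (pair-< n i)

    pair₂<n : proj₂ (pair n i) < n
    pair₂<n = proj₂ (pair-< n i)

    pair₁<n : proj₁ (pair n i) < n
    pair₁<n = <-trans pair₁<pair₂ pair₂<n

    pairBinder : Fin N
    pairBinder =
      binder (basic-Basic _ pair₁<n) (basic-Basic _ pair₂<n) (basic-≢ pair₁<n pair₂<n (<⇒≢ pair₁<pair₂))

    pairBinder-Binding : Binding n pairBinder
    pairBinder-Binding = binder-Binding _ _ _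

    pairBinder-nbrs : NbrsExactly G pairBinder (basic _ pair₁<n) (basic _ pair₂<n)
    pairBinder-nbrs = binder-nbrs _ _ _

  pairBinder-injective : Injective _≡_ _≡_ pairBinder
  pairBinder-injective {i} {j} eq with binder-≡ _ _ _ _ _ _ eq
  ... | inj₁ (a≡a′ , b≡b′) =
    pair-injective n (×-≡,≡→≡ (basic-≡ (pair₁<n i) (pair₁<n j) a≡a′ , basic-≡ (pair₂<n i) (pair₂<n j) b≡b′))
  ... | inj₂ (a≡b′ , b≡a′) = contradiction (pair₁<pair₂ i) (<-asym (subst₂ _<_
      (sym (basic-≡ (pair₂<n i) (pair₁<n j) b≡a′)) (sym (basic-≡ (pair₁<n i) (pair₂<n j) a≡b′))
      (pair₁<pair₂ j)))

  offset< : ∀ {v} → Binding n v → toℕ v ∸ n < choose₂ n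
  offset< {v} bv = subst (toℕ v ∸ n <_) (m+n∸m≡n n (choose₂ n))
                     (∸-monoˡ-< (subst (toℕ v <_) (order≡n+choose₂n n) (toℕ<n v)) bv)

  offset : ∀ v → Binding n v → Fin (choose₂ n)
  offset v bv = fromℕ< (offset< bv)

  offset-injective : ∀ {v w} (bv : Binding n v) (bw : Binding n w) → offset v bv ≡ offset w bw → v ≡ w
  offset-injective bv bw eq = toℕ-injective (∸-cancelʳ-≡ bv bw (begin
    toℕ _ ∸ n            ≡⟨ toℕ-fromℕ< (offset< bv) ⟨
    toℕ (offset _ bv)    ≡⟨ cong toℕ eq ⟩
    toℕ (offset _ bw)    ≡⟨ toℕ-fromℕ< (offset< bw) ⟩
    toℕ _ ∸ n            ∎))
    where open ≡-Reasoning

  offset∘pairBinder-injective : Injective _≡_ _≡_ (λ i → offset (pairBinder i) (pairBinder-Binding i))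
  offset∘pairBinder-injective eq =
    pairBinder-injective (offset-injective (pairBinder-Binding _) (pairBinder-Binding _) eq)

  binding-binds : ∀ {v} → Binding n v → ∃₂ λ a b → NbrsExactly G v a b
  binding-binds {v} bv
    with i , offset≡ ← injective⇒surjective offset∘pairBinder-injective (offset v bv)
    = _ , _ , subst (λ w → NbrsExactly G w (basic _ (pair₁<n i)) (basic _ (pair₂<n i)))
                    (offset-injective (pairBinder-Binding i) bv offset≡) (pairBinder-nbrs i)

  binding-degree : ∀ {v} → Binding n v → degree G v ≤ 2
  binding-degree bv = NbrsExactly⇒degree≤2 G (proj₂ (proj₂ (binding-binds bv)))

  basic-binding-separated : ∀ t {u v} → Basic n u → Binding n v → ¬ SameCell (WLstage G (suc t)) u v
  basic-binding-separated t bu bv same =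
    ≤⇒≯ (binding-degree bv) (subst (3 ≤_) (next-stage-degree G t same) (basic-degree bu))

  dim-G₁≤3 : dim (G₁ G) ≤ 3
  dim-G₁≤3 = ≤-trans (dim-G₁≤ G G-diagonal) (s≤s dim-G≤2)

  -- The four colours: a basic and a binding diagonal entry, and an edge and a non-edge at the
  -- binding vertex w = 0 ∧ 1 (the non-edge goes to the basic vertex 2).
  4≤dim-G₂ : 4 ≤ dim (WLstage G 1)
  4≤dim-G₂ = Unique⇒length≤ {xs = M u u ∷ M w w ∷ M w u ∷ M w x ∷ []}
               ((uu≢ww ∷ uu≢wu ∷ uu≢wx ∷ []) ∷ (ww≢wu ∷ ww≢wx ∷ []) ∷ (wu≢wx ∷ []) ∷ [] ∷ [])
               λ { (here refl)                         → entry u u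
                 ; (there (here refl))                 → entry w w
                 ; (there (there (here refl)))         → entry w u
                 ; (there (there (there (here refl)))) → entry w x
                 }
    where
    M : LGraph N
    M = WLstage G 1

    entry : ∀ i j → M i j ∈ deduplicate _≟_ (entries M)
    entry i j = ∈-deduplicate⁺ _≟_ (∈-entries M i j)

    0<n : 0 < n
    0<n = <-≤-trans z<s 3<n
    1<n : 1 < n
    1<n = <-≤-trans (s<s z<s) 3<n
    2<n : 2 < n
    2<n = <-≤-trans (s<s (s<s z<s)) 3<n

    u x w : Fin N
    u = basic 0 0<n
    x = basic 2 2<n
    w = binder (basic-Basic 0 0<n) (basic-Basic 1 1<n) (basic-≢ 0<n 1<n λ ())

    bw : Binding n w
    bw = binder-Binding _ _ _

    w≢u : w ≢ u
    w≢u = Basic≢Binding (basic-Basic 0 0<n) bw ∘ sym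
    w≢x : w ≢ x
    w≢x = Basic≢Binding (basic-Basic 2 2<n) bw ∘ sym

    uu≢ww : M u u ≢ M w w
    uu≢ww = basic-binding-separated 0 (basic-Basic 0 0<n) bw
    uu≢wu : M u u ≢ M w u
    uu≢wu = stage-separates G 1 w≢u ∘ sym
    uu≢wx : M u u ≢ M w x
    uu≢wx = stage-separates G 1 w≢x ∘ sym
    ww≢wu : M w w ≢ M w u
    ww≢wu = stage-separates G 1 w≢u ∘ sym
    ww≢wx : M w w ≢ M w x
    ww≢wx = stage-separates G 1 w≢x ∘ sym
    wu≢wx : M w u ≢ M w x
    wu≢wx eq =
      [ basic-≢ 2<n 0<n (λ ()) , basic-≢ 2<n 1<n (λ ()) ]′ (Equivalence.to (binder-nbrs _ _ _ x) wx-edge)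
      where
      wx-edge : Adj G w x
      wx-edge = stage-respects-Adj G 1 {w} {u} {w} {x} eq (Adj-sym (Adj-binder _ _ _))

  G₁-not-stable : dim (WLstage G 0) ≢ dim (WLstage G 1)
  G₁-not-stable stable = ≤⇒≯ dim-G₁≤3 (subst (3 <_) (sym stable) 4≤dim-G₂)

corollary5p3 : ∀ (n : ℕ) → 3 < n → (G : LGraph (order n)) → IsBindingGraph n G →
    ∀ (s : ℕ) → WLStopsAt G s →
    ∀ (u v : Fin (order n)) → Basic n u → Binding n v → ¬ SameCell (WLstage G s) u v
corollary5p3 n 3<n G isBinding zero (stable , _) _ _ _ _ _ = G₁-not-stable stable
  where open BindingGraph n 3<n G isBinding
corollary5p3 n 3<n G isBinding (suc t) _ _ _ = basic-binding-separated t
  where open BindingGraph n 3<n G isBinding
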